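{- Let $\Delta$ be a finite simplicial complex with a linear coloring $\kappa$, and let $\Delta_\kappa$ and $\Delta'_\kappa$ be two representative subcomplexes of $\Delta$ with respect to $\kappa$. Then $\Delta_\kappa$ and $\Delta'_\kappa$ are isomorphic as simplicial complexes.
   Context: For a simplicial complex $\Delta$ with vertex set $V$, $\mathcal{F}(v)$ is the set of facets (maximal faces) containing $v$; for $\kappa\colon V\to[k]=\{1,\dots,k\}$ and a face $S$, $S_\kappa(t)=|\{v\in S:\kappa(v)=t\}|$; a ($k$-)linear coloring is a surjective $\kappa$ with $\sum_t\min(F_\kappa(t),F'_\kappa(t))=|F\cap F'|$ for all facets $F,F'$. A representative subcomplex w.r.t. $\kappa$ is the subcomplex $\{S\in\Delta:S\subseteq W\}$ induced on a set $W\subseteq V$ containing exactly one vertex of each color, such that $\mathcal{F}(x)\subseteq\mathcal{F}(y)$ whenever $x\in V$, $y\in W$, $\kappa(x)=\kappa(y)$. -}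

module Defs where

open import Data.Nat using (ℕ; _⊓_)
open import Data.Fin using (Fin; _≟_)
open import Data.Fin.Subset using (Subset; _∈_; _⊆_; _∩_; ∣_∣; ⁅_⁆)
open import Data.Fin.Subset.Properties using (_∈?_)
open import Data.Fin.Properties using (any?)
open import Data.Vec using (tabulate)
import Data.Vec as Vec
open import Data.Product using (Σ; _×_; ∃; ∃-syntax)
open import Relation.Nullary using (Dec; does)
open import Relation.Nullary.Decidable using (_×-dec_)
open import Relation.Unary using (Decidable)
open import Relation.Binary.PropositionalEquality using (_≡_)
open import Function.Bundles using (_⇔_)
open import Level using (0ℓ; suc)

record SimplicialComplex (n : ℕ) : Set₁ where
  field
    IsFace      : Subset n → Set
    isFace?     : Decidable IsFace
    downClosed  : ∀ {S T} → IsFace S → T ⊆ S → IsFace T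
    vertexFaces : ∀ v → IsFace ⁅ v ⁆
open SimplicialComplex public

module _ {n : ℕ} (Δ : SimplicialComplex n) where

  IsFacet : Subset n → Set
  IsFacet F = IsFace Δ F × (∀ G → IsFace Δ G → F ⊆ G → G ≡ F)

  FacetsSub : Fin n → Fin n → Set
  FacetsSub x y = ∀ F → IsFacet F → x ∈ F → y ∈ F

colorClass : ∀ {n k} → (Fin n → Fin k) → Fin k → Subset n
colorClass κ t = tabulate (λ v → does (κ v ≟ t))

colorCount : ∀ {n k} → (Fin n → Fin k) → Subset n → Fin k → ℕ
colorCount κ S t = ∣ S ∩ colorClass κ t ∣

Surjective : ∀ {n k} → (Fin n → Fin k) → Set
Surjective {n} {k} κ = ∀ (t : Fin k) → ∃[ v ] κ v ≡ t

IsLinearColoring : ∀ {n k} → SimplicialComplex n → (Fin n → Fin k) → Set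
IsLinearColoring {n} {k} Δ κ =
  Surjective κ ×
  (∀ F F' → IsFacet Δ F → IsFacet Δ F' →
     Vec.sum (tabulate (λ t → colorCount κ F t ⊓ colorCount κ F' t)) ≡ ∣ F ∩ F' ∣)

-- W is the vertex set of a representative subcomplex w.r.t. κ
IsRepresentative : ∀ {n k} → SimplicialComplex n → (Fin n → Fin k) → Subset n → Set
IsRepresentative {n} {k} Δ κ W =
  (∀ (t : Fin k) → colorCount κ W t ≡ 1) ×
  (∀ x y → y ∈ W → κ x ≡ κ y → FacetsSub Δ x y)

InducedFace : ∀ {n} → SimplicialComplex n → Subset n → Subset n → Set
InducedFace Δ W S = IsFace Δ S × S ⊆ W

image : ∀ {n} → (Fin n → Fin n) → Subset n → Subset n
image f S = tabulate (λ y → does (any? (λ x → (x ∈? S) ×-dec (f x ≟ y))))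

IsSimplicialIso : ∀ {n} → SimplicialComplex n → Subset n → Subset n → (Fin n → Fin n) → Set
IsSimplicialIso {n} Δ W W' f =
  (∀ x → x ∈ W → f x ∈ W') ×
  (∀ x y → x ∈ W → y ∈ W → f x ≡ f y → x ≡ y) ×
  (∀ y → y ∈ W' → ∃[ x ] (x ∈ W × f x ≡ y)) ×
  (∀ S → S ⊆ W → (InducedFace Δ W S ⇔ InducedFace Δ W' (image f S)))

InducedIsomorphic : ∀ {n} → SimplicialComplex n → Subset n → Subset n → Set
InducedIsomorphic Δ W W' = ∃[ f ] IsSimplicialIso Δ W W' f

module Submission where

-- Matching each vertex of W with the vertex of W' of the same colour is a bijection W → W'.
-- The representative conditions give 𝓕(x) ⊆ 𝓕(x') and 𝓕(x') ⊆ 𝓕(x) for matched x ∈ W, x' ∈ W',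
-- so a facet containing a face S ⊆ W contains its image, and a facet containing the image
-- contains S. As every face lies in a facet, S and its image are faces together.

open import Defs
open import Data.Nat using (ℕ; zero; suc; _≤_; _<_; _+_)
open import Data.Nat.Properties using (≤-trans; <-irrefl; +-suc; +-monoʳ-≤; m≤m+n)
open import Data.Fin using (Fin; _≟_)
open import Data.Fin.Subset using (Subset; _∈_; _∉_; _⊆_; _⊂_; _∩_; _∪_; ∣_∣; ⁅_⁆)
open import Data.Fin.Subset.Properties
  using (_∈?_; nonempty?; Empty-unique; ∣⊥∣≡0; ∣⁅x⁆∣≡1; ∣p∣≤n; p⊂q⇒∣p∣<∣q∣; x∈⁅x⁆; x∈⁅y⁆⇒x≡y;
         x≢y⇒x∉⁅y⁆; p∩q⊆p; p∩q⊆q; x∈p∩q⁺; p⊆p∪q; q⊆p∪q; x∈p∪q⁻; ⊆-antisym)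
open import Data.Fin.Properties using (any?)
open import Data.Vec using (tabulate)
open import Data.Vec.Properties using (lookup∘tabulate; []=⇒lookup; lookup⇒[]=)
open import Data.Product using (_×_; ∃-syntax; _,_; proj₁; proj₂)
open import Data.Sum using (_⊎_; inj₁; inj₂; [_,_])
open import Function using (_∘_)
open import Relation.Nullary using (Dec; yes; no; does; contradiction)
open import Relation.Nullary.Decidable using (dec-true; ¬?; _×-dec_)
open import Relation.Binary.PropositionalEquality using (_≡_; module ≡-Reasoning; refl; sym; trans; cong; subst; subst₂)
open import Function.Bundles using (mk⇔)
open ≡-Reasoning

∈-tabulate⁺ : ∀ {n p} {P : Fin n → Set p} (P? : ∀ x → Dec (P x)) {x} →
              P x → x ∈ tabulate (λ y → does (P? y))
∈-tabulate⁺ P? {x} Px = lookup⇒[]= x _ (trans (lookup∘tabulate _ x) (dec-true (P? x) Px))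

∈-tabulate⁻ : ∀ {n p} {P : Fin n → Set p} (P? : ∀ x → Dec (P x)) {x} →
              x ∈ tabulate (λ y → does (P? y)) → P x
∈-tabulate⁻ P? {x} x∈ with P? x | trans (sym (lookup∘tabulate (λ y → does (P? y)) x)) ([]=⇒lookup x∈)
... | yes Px | _  = Px
... | no _   | ()

∈-image⁺ : ∀ {n} (f : Fin n → Fin n) {S x} → x ∈ S → f x ∈ image f S
∈-image⁺ f {S} {x} x∈S = ∈-tabulate⁺ (λ y → any? (λ x → (x ∈? S) ×-dec (f x ≟ y))) (x , x∈S , refl)

∈-image⁻ : ∀ {n} (f : Fin n → Fin n) {S y} → y ∈ image f S → ∃[ x ] x ∈ S × f x ≡ y
∈-image⁻ f {S} = ∈-tabulate⁻ (λ y → any? (λ x → (x ∈? S) ×-dec (f x ≟ y)))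

∈-colorClass⁺ : ∀ {n k} (κ : Fin n → Fin k) {x t} → κ x ≡ t → x ∈ colorClass κ t
∈-colorClass⁺ κ {t = t} = ∈-tabulate⁺ (λ y → κ y ≟ t)

∈-colorClass⁻ : ∀ {n k} (κ : Fin n → Fin k) {x t} → x ∈ colorClass κ t → κ x ≡ t
∈-colorClass⁻ κ {t = t} = ∈-tabulate⁻ (λ y → κ y ≟ t)

x∈p⇒⁅x⁆⊆p : ∀ {n x} {p : Subset n} → x ∈ p → ⁅ x ⁆ ⊆ p
x∈p⇒⁅x⁆⊆p {x = x} {p} x∈p y∈⁅x⁆ = subst (_∈ p) (sym (x∈⁅y⁆⇒x≡y x y∈⁅x⁆)) x∈p

∪-lub : ∀ {n} {p q r : Subset n} → p ⊆ r → q ⊆ r → p ∪ q ⊆ r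
∪-lub {p = p} {q} p⊆r q⊆r x∈p∪q = [ p⊆r , q⊆r ] (x∈p∪q⁻ p q x∈p∪q)

∣p∣≡1⇒Nonempty : ∀ {n} (p : Subset n) → ∣ p ∣ ≡ 1 → ∃[ x ] x ∈ p
∣p∣≡1⇒Nonempty {n} p ∣p∣≡1 with nonempty? p
... | yes p≢∅ = p≢∅
... | no  p≡∅ with () ← trans (sym (∣⊥∣≡0 n)) (trans (cong ∣_∣ (sym (Empty-unique p≡∅))) ∣p∣≡1)

∣p∣≡1⇒x∈p⇒y∈p⇒x≡y : ∀ {n} (p : Subset n) → ∣ p ∣ ≡ 1 → ∀ {x y} → x ∈ p → y ∈ p → x ≡ y
∣p∣≡1⇒x∈p⇒y∈p⇒x≡y p ∣p∣≡1 {x} {y} x∈p y∈p with x ≟ y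
... | yes x≡y = x≡y
... | no  x≢y = contradiction (subst₂ _<_ (∣⁅x⁆∣≡1 y) ∣p∣≡1 (p⊂q⇒∣p∣<∣q∣ ⁅y⁆⊂p)) (<-irrefl refl)
  where
  ⁅y⁆⊂p : ⁅ y ⁆ ⊂ p
  ⁅y⁆⊂p = x∈p⇒⁅x⁆⊆p y∈p , x , x∈p , x≢y⇒x∉⁅y⁆ x≢y

module _ {n : ℕ} (Δ : SimplicialComplex n) where

  facet-or-extendable : ∀ {S} → IsFace Δ S → IsFacet Δ S ⊎ ∃[ v ] v ∉ S × IsFace Δ (S ∪ ⁅ v ⁆)
  facet-or-extendable {S} S∈Δ with any? (λ v → ¬? (v ∈? S) ×-dec isFace? Δ (S ∪ ⁅ v ⁆))
  ... | yes extension = inj₂ extension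
  ... | no  maximal   = inj₁ (S∈Δ , λ G G∈Δ S⊆G → ⊆-antisym (G⊆S G∈Δ S⊆G) S⊆G)
    where
    G⊆S : ∀ {G} → IsFace Δ G → S ⊆ G → G ⊆ S
    G⊆S G∈Δ S⊆G {z} z∈G with z ∈? S
    ... | yes z∈S = z∈S
    ... | no  z∉S = contradiction (z , z∉S , downClosed Δ G∈Δ (∪-lub S⊆G (x∈p⇒⁅x⁆⊆p z∈G))) maximal

  -- Each extension enlarges the face, so the fuel m with n ≤ m + ∣ S ∣ bounds the number of steps.
  face⊆facet-bounded : ∀ m {S} → n ≤ m + ∣ S ∣ → IsFace Δ S → ∃[ F ] IsFacet Δ F × S ⊆ F
  face⊆facet-bounded m {S} n≤m+∣S∣ S∈Δ with facet-or-extendable S∈Δ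
  ... | inj₁ S-facet = S , S-facet , λ x∈S → x∈S
  ... | inj₂ (v , v∉S , S+v∈Δ) = extend m n≤m+∣S∣
    where
    ∣S∣<∣S+v∣ : ∣ S ∣ < ∣ S ∪ ⁅ v ⁆ ∣
    ∣S∣<∣S+v∣ = p⊂q⇒∣p∣<∣q∣ (p⊆p∪q ⁅ v ⁆ , v , q⊆p∪q S ⁅ v ⁆ (x∈⁅x⁆ v) , v∉S)

    fuel-decreases : ∀ m → n ≤ suc m + ∣ S ∣ → n ≤ m + ∣ S ∪ ⁅ v ⁆ ∣
    fuel-decreases m n≤1+m+∣S∣ =
      ≤-trans n≤1+m+∣S∣ (subst (_≤ m + ∣ S ∪ ⁅ v ⁆ ∣) (+-suc m ∣ S ∣) (+-monoʳ-≤ m ∣S∣<∣S+v∣))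

    extend : ∀ m → n ≤ m + ∣ S ∣ → ∃[ F ] IsFacet Δ F × S ⊆ F
    extend zero    n≤∣S∣ = contradiction (≤-trans ∣S∣<∣S+v∣ (≤-trans (∣p∣≤n (S ∪ ⁅ v ⁆)) n≤∣S∣)) (<-irrefl refl)
    extend (suc m) n≤1+m+∣S∣
      with F , F-facet , S+v⊆F ← face⊆facet-bounded m (fuel-decreases m n≤1+m+∣S∣) S+v∈Δ
      = F , F-facet , S+v⊆F ∘ p⊆p∪q ⁅ v ⁆

  face⊆facet : ∀ {S} → IsFace Δ S → ∃[ F ] IsFacet Δ F × S ⊆ F
  face⊆facet {S} = face⊆facet-bounded n (m≤m+n n ∣ S ∣)

  face-if-covered : ∀ {S T} → IsFace Δ S → (∀ {y} → y ∈ T → ∃[ x ] x ∈ S × FacetsSub Δ x y) → IsFace Δ T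
  face-if-covered S∈Δ covered with F , F-facet , S⊆F ← face⊆facet S∈Δ =
    downClosed Δ (proj₁ F-facet) λ y∈T →
      let x , x∈S , 𝓕x⊆𝓕y = covered y∈T in 𝓕x⊆𝓕y F F-facet (S⊆F x∈S)

module Representative {n k} (κ : Fin n → Fin k) (W : Subset n)
                      (oneOfEachColor : ∀ t → colorCount κ W t ≡ 1) where

  rep : Fin k → Fin n
  rep t = proj₁ (∣p∣≡1⇒Nonempty (W ∩ colorClass κ t) (oneOfEachColor t))

  rep∈W∩colorClass : ∀ t → rep t ∈ W ∩ colorClass κ t
  rep∈W∩colorClass t = proj₂ (∣p∣≡1⇒Nonempty (W ∩ colorClass κ t) (oneOfEachColor t))

  rep∈W : ∀ t → rep t ∈ W
  rep∈W t = p∩q⊆p W (colorClass κ t) (rep∈W∩colorClass t)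

  κ∘rep : ∀ t → κ (rep t) ≡ t
  κ∘rep t = ∈-colorClass⁻ κ (p∩q⊆q W (colorClass κ t) (rep∈W∩colorClass t))

  rep∘κ : ∀ {y} → y ∈ W → rep (κ y) ≡ y
  rep∘κ {y} y∈W = ∣p∣≡1⇒x∈p⇒y∈p⇒x≡y (W ∩ colorClass κ (κ y)) (oneOfEachColor (κ y))
    (rep∈W∩colorClass (κ y)) (x∈p∩q⁺ (y∈W , ∈-colorClass⁺ κ refl))

module Matching {n k} (Δ : SimplicialComplex n) (κ : Fin n → Fin k) {W W' : Subset n}
                (W-rep : IsRepresentative Δ κ W) (W'-rep : IsRepresentative Δ κ W') where

  private
    module R  = Representative κ W  (proj₁ W-rep)
    module R' = Representative κ W' (proj₁ W'-rep)

  match : Fin n → Fin n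
  match = R'.rep ∘ κ

  match∈W' : ∀ x → match x ∈ W'
  match∈W' x = R'.rep∈W (κ x)

  κ∘match : ∀ x → κ (match x) ≡ κ x
  κ∘match x = R'.κ∘rep (κ x)

  match-injective : ∀ x y → x ∈ W → y ∈ W → match x ≡ match y → x ≡ y
  match-injective x y x∈W y∈W mx≡my = begin
    x            ≡⟨ R.rep∘κ x∈W ⟨
    R.rep (κ x)  ≡⟨ cong R.rep (trans (sym (κ∘match x)) (trans (cong κ mx≡my) (κ∘match y))) ⟩
    R.rep (κ y)  ≡⟨ R.rep∘κ y∈W ⟩
    y            ∎

  match-surjective : ∀ y → y ∈ W' → ∃[ x ] x ∈ W × match x ≡ y
  match-surjective y y∈W' = R.rep (κ y) , R.rep∈W (κ y) , (begin
    R'.rep (κ (R.rep (κ y)))  ≡⟨ cong R'.rep (R.κ∘rep (κ y)) ⟩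
    R'.rep (κ y)              ≡⟨ R'.rep∘κ y∈W' ⟩
    y                         ∎)

  image-match⊆W' : ∀ S → image match S ⊆ W'
  image-match⊆W' S y∈image with x , _ , refl ← ∈-image⁻ match y∈image = match∈W' x

  match-preserves-faces : ∀ {S} → IsFace Δ S → IsFace Δ (image match S)
  match-preserves-faces S∈Δ = face-if-covered Δ S∈Δ λ y∈image →
    let x , x∈S , mx≡y = ∈-image⁻ match y∈image
    in x , x∈S , subst (FacetsSub Δ x) mx≡y
                   (proj₂ W'-rep x (match x) (match∈W' x) (sym (κ∘match x)))

  match-reflects-faces : ∀ {S} → S ⊆ W → IsFace Δ (image match S) → IsFace Δ S
  match-reflects-faces S⊆W image∈Δ = face-if-covered Δ image∈Δ λ {x} x∈S →
    match x , ∈-image⁺ match x∈S , proj₂ W-rep (match x) x (S⊆W x∈S) (κ∘match x)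

proposition4p2 : (n k : ℕ) (Δ : SimplicialComplex n) (κ : Fin n → Fin k)
    → IsLinearColoring Δ κ
    → (W W' : Subset n)
    → IsRepresentative Δ κ W
    → IsRepresentative Δ κ W'
    → InducedIsomorphic Δ W W'
proposition4p2 n k Δ κ _ W W' W-rep W'-rep =
  match , (λ x _ → match∈W' x) , match-injective , match-surjective , λ S S⊆W → mk⇔
    (λ (S∈Δ , _)     → match-preserves-faces S∈Δ , image-match⊆W' S)
    (λ (image∈Δ , _) → match-reflects-faces S⊆W image∈Δ , S⊆W)
  where open Matching Δ κ W-rep W'-rep
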